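{- Assume Dickson's conjecture. Then there exist infinitely many primes $q$ such that $2q+1$, $6q+1$ and $8q+1$ are all prime, but $iq+1$ is not prime for each $i\in\{10,12,14,16,18\}$.
   Context: Dickson's conjecture is the following hypothesis: for any integers $a_1,\dots,a_k$ and positive integers $b_1,\dots,b_k$, there are infinitely many positive integers $n$ for which all of $a_1+b_1n,\dots,a_k+b_kn$ are prime, unless there exists a prime $q$ such that the product $(a_1+b_1n)\cdots(a_k+b_kn)$ is divisible by $q$ for every $n\in\{0,1,\dots,q-1\}$. -}

module Defs where

open import Data.Nat as ℕ using (ℕ; zero; suc; _<_; _≤_)
open import Data.Nat.Primality using (Prime)
open import Data.Integer as ℤ using (ℤ; +_)
open import Data.Integer.Divisibility using (_∣_)
open import Data.Fin using (Fin)
open import Data.Product using (Σ; _×_; ∃-syntax)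
open import Relation.Binary.PropositionalEquality using (_≡_)
open import Relation.Nullary using (¬_)

IsPrimeℤ : ℤ → Set
IsPrimeℤ z = Σ ℕ λ p → (z ≡ + p) × Prime p

∏ : (k : ℕ) → (Fin k → ℤ) → ℤ
∏ zero    f = + 1
∏ (suc k) f = f Fin.zero ℤ.* ∏ k (λ i → f (Fin.suc i))
  where import Data.Fin as Fin

form : {k : ℕ} → (Fin k → ℤ) → (Fin k → ℕ) → Fin k → ℕ → ℤ
form a b i n = a i ℤ.+ (+ b i) ℤ.* (+ n)

Obstruction : (k : ℕ) → (Fin k → ℤ) → (Fin k → ℕ) → ℕ → Set
Obstruction k a b q = Prime q × ((n : ℕ) → n < q → (+ q) ∣ ∏ k (λ i → form a b i n))

DicksonConjecture : Set
DicksonConjecture =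
  (k : ℕ) (a : Fin k → ℤ) (b : Fin k → ℕ) →
  ((i : Fin k) → 0 < b i) →
  ¬ (Σ ℕ λ q → Obstruction k a b q) →
  (N : ℕ) → ∃[ n ] (N < n × ((i : Fin k) → IsPrimeℤ (form a b i n)))

-- Apply Dickson's conjecture to the four forms q, 2q + 1, 6q + 1, 8q + 1 with
-- q = 641 + 2310 n.  Since 2310 = 2·3·5·7·11, the residue of q modulo 3, 5, 7, 11
-- is fixed, and 641 is chosen so that 10q + 1, 12q + 1, 14q + 1, 16q + 1, 18q + 1
-- are proper multiples of 3, 7, 5, 3, 11 respectively.
-- There is no local obstruction: the product P of the forms is a quartic in n, so
-- Δ⁴P is the constant 4!·2310·4620·13860·18480, whose prime factors are 2, 3, 5, 7
-- and 11.  None of them divides P 0 = 641·1283·3847·5129, so some integer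
-- combination of P 0 and Δ⁴P 0 equals 1.  A prime p ≥ 5 dividing P 0, …, P 4
-- divides Δ⁴P 0 as well, hence divides 1; and 2 and 3 do not divide P 0.
module Submission where

open import Defs
open import Data.Nat using (ℕ; _<_; _*_; _+_)
open import Data.Nat.Primality using (Prime)
open import Data.Product using (_×_; ∃-syntax)
open import Relation.Nullary using (¬_)
open import Data.Nat as ℕ using (zero; suc; z≤n; s≤s; _≤_; NonTrivial)
open import Data.Nat.Properties using (≤-trans; m≤n⇒m≤1+n; m≤m+n; m≤n+m; m<m*n; <-≤-trans; m≤n*m)
open import Data.Nat.Primality using (composite; composite⇒¬prime; composite[4]; ¬prime[0]; ¬prime[1])
open import Data.Nat.Divisibility using (m∣m*n; ∣1⇒≡1; _∣?_)
open import Data.Integer as ℤ using (ℤ; +_)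
open import Data.Integer.Properties using (pos-*)
open import Data.Integer.Divisibility.Signed using (∣ᵤ⇒∣; ∣⇒∣ᵤ; ∣m∣n⇒∣m-n; ∣m∣n⇒∣m+n; ∣n⇒∣m*n)
import Data.Integer.Divisibility.Signed as ℤ∣
open import Data.Fin using (Fin) renaming (zero to 0F; suc to sucF)
open import Data.Product using (Σ; _,_; ∃₂)
open import Function using (_∘_)
open import Relation.Binary.PropositionalEquality using (_≡_; refl; sym; cong; subst)
open import Relation.Nullary.Decidable using (toWitnessFalse)
open import Data.Nat.Tactic.RingSolver using (solve-∀)

Δ : (ℕ → ℤ) → ℕ → ℤ
Δ f n = f (suc n) ℤ.- f n

Δ^ : ℕ → (ℕ → ℤ) → ℕ → ℤ
Δ^ zero    f = f
Δ^ (suc k) f = Δ^ k (Δ f)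

∣-Δ^ : ∀ {d} k (f : ℕ → ℤ) → (∀ n → n ≤ k → d ℤ∣.∣ f n) → d ℤ∣.∣ Δ^ k f 0
∣-Δ^ zero    f d∣f = d∣f 0 z≤n
∣-Δ^ (suc k) f d∣f = ∣-Δ^ k (Δ f) λ n n≤k →
  ∣m∣n⇒∣m-n (d∣f (suc n) (s≤s n≤k)) (d∣f n (m≤n⇒m≤1+n n≤k))

∣-Δ^-bézout⇒∣1 : ∀ {d} k (f : ℕ → ℤ) → (∃₂ λ x y → x ℤ.* f 0 ℤ.+ y ℤ.* Δ^ k f 0 ≡ + 1) →
                 (∀ n → n ≤ k → d ℤ∣.∣ f n) → d ℤ∣.∣ + 1
∣-Δ^-bézout⇒∣1 k f (x , y , bézout) d∣f = subst (_ ℤ∣.∣_) bézout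
  (∣m∣n⇒∣m+n (∣n⇒∣m*n x (d∣f 0 z≤n)) (∣n⇒∣m*n y (∣-Δ^ k f d∣f)))

isPrimeℤ-pos⇒prime : ∀ {m} → IsPrimeℤ (+ m) → Prime m
isPrimeℤ-pos⇒prime (_ , refl , prime-m) = prime-m

isPrimeℤ-linear⇒prime : ∀ a b n {m} → a + b * n ≡ m → IsPrimeℤ (+ a ℤ.+ + b ℤ.* + n) → Prime m
isPrimeℤ-linear⇒prime a b n refl =
  isPrimeℤ-pos⇒prime ∘ subst IsPrimeℤ (cong (λ z → + a ℤ.+ z) (sym (pos-* b n)))

m≡d*k⇒¬prime : ∀ d k {m} → .{{NonTrivial d}} → .{{NonTrivial k}} → m ≡ d * k → ¬ Prime m
m≡d*k⇒¬prime d k refl =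
  composite⇒¬prime (composite (m<m*n d k {{ℕ.nonTrivial⇒nonZero d}} (ℕ.nonTrivial⇒n>1 k)) (m∣m*n k))

offset : Fin 4 → ℤ
offset 0F                      = + 641
offset (sucF 0F)               = + 1283
offset (sucF (sucF 0F))        = + 3847
offset (sucF (sucF (sucF 0F))) = + 5129

slope : Fin 4 → ℕ
slope 0F                      = 2310
slope (sucF 0F)               = 4620
slope (sucF (sucF 0F))        = 13860
slope (sucF (sucF (sucF 0F))) = 18480

slope-positive : (i : Fin 4) → 0 < slope i
slope-positive 0F                      = s≤s z≤n
slope-positive (sucF 0F)               = s≤s z≤n
slope-positive (sucF (sucF 0F))        = s≤s z≤n
slope-positive (sucF (sucF (sucF 0F))) = s≤s z≤n

P : ℕ → ℤ
P n = ∏ 4 (λ i → form offset slope i n)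

bézout[P0,Δ⁴P0] : ∃₂ λ x y → x ℤ.* P 0 ℤ.+ y ℤ.* Δ^ 4 P 0 ≡ + 1
bézout[P0,Δ⁴P0] = ℤ.- (+ 29428900718874091) , + 7279192705288 , refl

noObstruction : ¬ (Σ ℕ λ q → Obstruction 4 offset slope q)
noObstruction (0 , prime-q , _) = ¬prime[0] prime-q
noObstruction (1 , prime-q , _) = ¬prime[1] prime-q
noObstruction (2 , _ , q∣P) = toWitnessFalse {a? = 2 ∣? ℤ.∣ P 0 ∣} _ (q∣P 0 (s≤s z≤n))
noObstruction (3 , _ , q∣P) = toWitnessFalse {a? = 3 ∣? ℤ.∣ P 0 ∣} _ (q∣P 0 (s≤s z≤n))
noObstruction (4 , prime-q , _) = composite⇒¬prime composite[4] prime-q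
noObstruction (q@(suc (suc (suc (suc (suc r))))) , _ , q∣P) = ℕ.nonTrivial⇒≢1 (∣1⇒≡1 (∣⇒∣ᵤ q∣1))
  where
  q∣1 : + q ℤ∣.∣ + 1
  q∣1 = ∣-Δ^-bézout⇒∣1 4 P bézout[P0,Δ⁴P0] λ n n≤4 →
          ∣ᵤ⇒∣ (q∣P n (s≤s (≤-trans n≤4 (m≤m+n 4 r))))

q : ℕ → ℕ
q n = 641 + 2310 * n

prime[2q+1] : ∀ n → IsPrimeℤ (form offset slope (sucF 0F) n) → Prime (2 * q n + 1)
prime[2q+1] n = isPrimeℤ-linear⇒prime 1283 4620 n (eq n)
  where eq : ∀ n → 1283 + 4620 * n ≡ 2 * (641 + 2310 * n) + 1
        eq = solve-∀

prime[6q+1] : ∀ n → IsPrimeℤ (form offset slope (sucF (sucF 0F)) n) → Prime (6 * q n + 1)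
prime[6q+1] n = isPrimeℤ-linear⇒prime 3847 13860 n (eq n)
  where eq : ∀ n → 3847 + 13860 * n ≡ 6 * (641 + 2310 * n) + 1
        eq = solve-∀

prime[8q+1] : ∀ n → IsPrimeℤ (form offset slope (sucF (sucF (sucF 0F))) n) → Prime (8 * q n + 1)
prime[8q+1] n = isPrimeℤ-linear⇒prime 5129 18480 n (eq n)
  where eq : ∀ n → 5129 + 18480 * n ≡ 8 * (641 + 2310 * n) + 1
        eq = solve-∀

¬prime[10q+1] : ∀ n → ¬ Prime (10 * q n + 1)
¬prime[10q+1] n = m≡d*k⇒¬prime 3 (2137 + 7700 * n) (eq n)
  where eq : ∀ n → 10 * (641 + 2310 * n) + 1 ≡ 3 * (2137 + 7700 * n)
        eq = solve-∀

¬prime[12q+1] : ∀ n → ¬ Prime (12 * q n + 1)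
¬prime[12q+1] n = m≡d*k⇒¬prime 7 (1099 + 3960 * n) (eq n)
  where eq : ∀ n → 12 * (641 + 2310 * n) + 1 ≡ 7 * (1099 + 3960 * n)
        eq = solve-∀

¬prime[14q+1] : ∀ n → ¬ Prime (14 * q n + 1)
¬prime[14q+1] n = m≡d*k⇒¬prime 5 (1795 + 6468 * n) (eq n)
  where eq : ∀ n → 14 * (641 + 2310 * n) + 1 ≡ 5 * (1795 + 6468 * n)
        eq = solve-∀

¬prime[16q+1] : ∀ n → ¬ Prime (16 * q n + 1)
¬prime[16q+1] n = m≡d*k⇒¬prime 3 (3419 + 12320 * n) (eq n)
  where eq : ∀ n → 16 * (641 + 2310 * n) + 1 ≡ 3 * (3419 + 12320 * n)
        eq = solve-∀

¬prime[18q+1] : ∀ n → ¬ Prime (18 * q n + 1)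
¬prime[18q+1] n = m≡d*k⇒¬prime 11 (1049 + 3780 * n) (eq n)
  where eq : ∀ n → 18 * (641 + 2310 * n) + 1 ≡ 11 * (1049 + 3780 * n)
        eq = solve-∀

n≤q : ∀ n → n ≤ q n
n≤q n = ≤-trans (m≤n*m n 2310) (m≤n+m (2310 * n) 641)

lemma6p2 : DicksonConjecture →
    (N : ℕ) → ∃[ q ] (N < q × Prime q
    × Prime (2 * q + 1) × Prime (6 * q + 1) × Prime (8 * q + 1)
    × ¬ Prime (10 * q + 1) × ¬ Prime (12 * q + 1) × ¬ Prime (14 * q + 1)
    × ¬ Prime (16 * q + 1) × ¬ Prime (18 * q + 1))
lemma6p2 dickson N =
  let n , N<n , prime-form = dickson 4 offset slope slope-positive noObstruction N in
  q n , <-≤-trans N<n (n≤q n)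
  , isPrimeℤ-linear⇒prime 641 2310 n refl (prime-form 0F)
  , prime[2q+1] n (prime-form (sucF 0F))
  , prime[6q+1] n (prime-form (sucF (sucF 0F)))
  , prime[8q+1] n (prime-form (sucF (sucF (sucF 0F))))
  , ¬prime[10q+1] n , ¬prime[12q+1] n , ¬prime[14q+1] n , ¬prime[16q+1] n , ¬prime[18q+1] n
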